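{- Let $\mathsf{P}:\mathbf{Set}^{\mathrm{op}}\to\mathbf{HA}$ be the tripos induced by an implicative algebra $(\mathscr{A},{\preccurlyeq},{\to},S)$. Then the following are equivalent: (1) $\mathsf{P}$ is isomorphic to a forcing tripos. (2) The separator $S\subseteq\mathscr{A}$ is a principal filter of $\mathscr{A}$. (3) The separator $S\subseteq\mathscr{A}$ is finitely generated and ${\pitchfork}^{\mathscr{A}}\in S$.
   Context: An implicative structure $(\mathscr{A},\preccurlyeq,\to)$ is a complete lattice (meets $\bigwedge$, binary meet $\wedge$, top $\top$, bottom $\bot$) with an operation $\to$ anti-monotonic in its first and monotonic in its second argument, satisfying $a\to\bigwedge_{b\in B}b=\bigwedge_{b\in B}(a\to b)$ for all $B\subseteq\mathscr{A}$. Application is $ab=\bigwedge\{c:a\preccurlyeq(b\to c)\}$, abstraction of $f:\mathscr{A}\to\mathscr{A}$ is $\bigwedge_{a}(a\to f(a))$, and closed $\lambda$-terms $t$ with parameters in $\mathscr{A}$ are interpreted as $t^{\mathscr{A}}$ accordingly. A separator is an upwards closed $S\subseteq\mathscr{A}$ containing $\mathbf{K}^{\mathscr{A}}=(\lambda xy.x)^{\mathscr{A}}$ and $\mathbf{S}^{\mathscr{A}}=(\lambda xyz.xz(yz))^{\mathscr{A}}$ and closed under modus ponens; an implicative algebra is an implicative structure with a separator. $S$ is finitely generated if it is the smallest separator containing some finite subset $X\subseteq\mathscr{A}$. The non-deterministic choice operator is ${\pitchfork}^{\mathscr{A}}=(\lambda xy.x)^{\mathscr{A}}\wedge(\lambda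 xy.y)^{\mathscr{A}}=\bigwedge_{a,b\in\mathscr{A}}(a\to b\to a\wedge b)$. The induced tripos is $\mathsf{P}I=\mathscr{A}^I/S[I]$, where $\mathscr{A}^I$ is the componentwise product structure, $S[I]=\{a\in\mathscr{A}^I:\exists s\in S,\forall i,\ s\preccurlyeq a_i\}$, and the quotient is the poset reflection of the preorder $a\vdash b$ iff $(a\to b)\in S[I]$; $\mathsf{P}f$ is induced by reindexing $a\mapsto a\circ f$. A forcing tripos is the functor $I\mapsto H^I$ (with $\mathsf{P}f=(h\mapsto h\circ f)$) for a complete Heyting algebra $H$. Two triposes $\mathsf{P},\mathsf{P}'$ are isomorphic if there is a natural isomorphism $\phi:\mathsf{P}\Rightarrow\mathsf{P}'$, i.e. isomorphisms $\phi_I:\mathsf{P}I\to\mathsf{P}'I$ with $\mathsf{P}'f\circ\phi_J=\phi_I\circ\mathsf{P}f$ for all $f:I\to J$. -}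

module Defs where

open import Level using (Level; _⊔_; Lift; lift) renaming (suc to lsuc)
open import Data.Bool using (Bool; true; false)
open import Data.Product using (Σ; ∃; _×_; _,_; proj₁; proj₂)
open import Data.Nat using (ℕ)
open import Data.Fin using (Fin)

-- The complete lattice is presented as a preorder (_≼_) whose
-- equality is mutual ≼ (setoid style, no quotients in Agda);
-- ⋀ is the greatest lower bound of any family indexed by a Set ℓ
-- (families play the role of subsets B ⊆ 𝒜).

record ImplicativeStructure (ℓ : Level) : Set (lsuc ℓ) where
  infix  4 _≼_ _≈_
  infixr 5 _⇒_
  field
    Carrier : Set ℓ
    _≼_     : Carrier → Carrier → Set ℓ
    ≼-refl  : ∀ {a} → a ≼ a
    ≼-trans : ∀ {a b c} → a ≼ b → b ≼ c → a ≼ c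
    ⋀       : {I : Set ℓ} → (I → Carrier) → Carrier
    ⋀-lb    : ∀ {I : Set ℓ} (f : I → Carrier) (i : I) → ⋀ f ≼ f i
    ⋀-glb   : ∀ {I : Set ℓ} (f : I → Carrier) (c : Carrier) →
              (∀ i → c ≼ f i) → c ≼ ⋀ f
    _⇒_     : Carrier → Carrier → Carrier
    ⇒-mono  : ∀ {a a′ b b′} → a′ ≼ a → b ≼ b′ → (a ⇒ b) ≼ (a′ ⇒ b′)

  _≈_ : Carrier → Carrier → Set ℓ
  a ≈ b = (a ≼ b) × (b ≼ a)

  field
    ⇒-⋀ : ∀ (a : Carrier) {I : Set ℓ} (f : I → Carrier) →
          (a ⇒ ⋀ f) ≈ ⋀ (λ i → a ⇒ f i)

  private
    pair : Carrier → Carrier → Lift ℓ Bool → Carrier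
    pair a b (lift true)  = a
    pair a b (lift false) = b

  _∧_ : Carrier → Carrier → Carrier
  a ∧ b = ⋀ (pair a b)

  app : Carrier → Carrier → Carrier
  app a b = ⋀ {Σ Carrier (λ c → a ≼ (b ⇒ c))} proj₁

  abs : (Carrier → Carrier) → Carrier
  abs f = ⋀ {Carrier} (λ a → a ⇒ f a)

  𝐊 : Carrier
  𝐊 = abs (λ x → abs (λ y → x))

  𝐊𝐈 : Carrier
  𝐊𝐈 = abs (λ x → abs (λ y → y))

  𝐒 : Carrier
  𝐒 = abs (λ x → abs (λ y → abs (λ z → app (app x z) (app y z))))

  ⋔ : Carrier
  ⋔ = 𝐊 ∧ 𝐊𝐈

  record IsSeparator (S : Carrier → Set ℓ) : Set ℓ where
    field
      upward : ∀ {a b} → S a → a ≼ b → S b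
      has-𝐊  : S 𝐊
      has-𝐒  : S 𝐒
      mp     : ∀ {a b} → S (a ⇒ b) → S a → S b

record ImplicativeAlgebra (ℓ : Level) : Set (lsuc ℓ) where
  field
    structure : ImplicativeStructure ℓ
  open ImplicativeStructure structure public
  field
    S           : Carrier → Set ℓ
    isSeparator : IsSeparator S

  IsPrincipalFilter : Set ℓ
  IsPrincipalFilter = Σ Carrier λ s → ∀ a → (S a → s ≼ a) × (s ≼ a → S a)

  GeneratedBy : ∀ {n} → (Fin n → Carrier) → Set (lsuc ℓ)
  GeneratedBy X = (∀ i → S (X i)) ×
                  (∀ (S′ : Carrier → Set ℓ) → IsSeparator S′ →
                     (∀ i → S′ (X i)) → ∀ a → S a → S′ a)

  FinitelyGenerated : Set (lsuc ℓ)
  FinitelyGenerated = Σ ℕ λ n → Σ (Fin n → Carrier) λ X → GeneratedBy X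

  -- The induced tripos:  P I = 𝒜^I / S[I]  (represented by families I → 𝒜
  -- with the entailment preorder; equality in P I is mutual entailment).
  _∈S[_] : ∀ {I : Set ℓ} → (I → Carrier) → Set ℓ → Set ℓ
  a ∈S[ I ] = Σ Carrier λ s → S s × (∀ i → s ≼ a i)

  _⊢[_]_ : ∀ {I : Set ℓ} → (I → Carrier) → Set ℓ → (I → Carrier) → Set ℓ
  _⊢[_]_ {I} a _ b = (λ i → a i ⇒ b i) ∈S[ I ]

record CompleteHeytingAlgebra (ℓ : Level) : Set (lsuc ℓ) where
  infix 4 _≤_ _≈_
  field
    Carrier : Set ℓ
    _≤_     : Carrier → Carrier → Set ℓ
    ≤-refl  : ∀ {a} → a ≤ a
    ≤-trans : ∀ {a b c} → a ≤ b → b ≤ c → a ≤ c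
    ⋀       : {I : Set ℓ} → (I → Carrier) → Carrier
    ⋀-lb    : ∀ {I : Set ℓ} (f : I → Carrier) (i : I) → ⋀ f ≤ f i
    ⋀-glb   : ∀ {I : Set ℓ} (f : I → Carrier) (c : Carrier) →
              (∀ i → c ≤ f i) → c ≤ ⋀ f
    ⋁       : {I : Set ℓ} → (I → Carrier) → Carrier
    ⋁-ub    : ∀ {I : Set ℓ} (f : I → Carrier) (i : I) → f i ≤ ⋁ f
    ⋁-lub   : ∀ {I : Set ℓ} (f : I → Carrier) (c : Carrier) →
              (∀ i → f i ≤ c) → ⋁ f ≤ c
    _∧_     : Carrier → Carrier → Carrier
    ∧-lbˡ   : ∀ a b → a ∧ b ≤ a
    ∧-lbʳ   : ∀ a b → a ∧ b ≤ b
    ∧-glb   : ∀ {a b c} → c ≤ a → c ≤ b → c ≤ a ∧ b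
    _⇨_     : Carrier → Carrier → Carrier
    ⇨-adjˡ  : ∀ {a b c} → a ∧ b ≤ c → a ≤ b ⇨ c
    ⇨-adjʳ  : ∀ {a b c} → a ≤ b ⇨ c → a ∧ b ≤ c

  _≈_ : Carrier → Carrier → Set ℓ
  a ≈ b = (a ≤ b) × (b ≤ a)

-- Maps on the quotients P I are given on
-- representatives and required to respect the orders; being mutually
-- inverse up to the respective equalities makes each φ_I an isomorphism
-- of posets (hence of Heyting algebras).

record TriposIso {ℓ} (𝒜 : ImplicativeAlgebra ℓ) (H : CompleteHeytingAlgebra ℓ)
       : Set (lsuc ℓ) where
  private
    module A = ImplicativeAlgebra 𝒜
    module H = CompleteHeytingAlgebra H
  field
    φ : (I : Set ℓ) → (I → A.Carrier) → (I → H.Carrier)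
    ψ : (I : Set ℓ) → (I → H.Carrier) → (I → A.Carrier)
    φ-mono : ∀ (I : Set ℓ) (a b : I → A.Carrier) →
             a A.⊢[ I ] b → ∀ i → φ I a i H.≤ φ I b i
    ψ-mono : ∀ (I : Set ℓ) (h k : I → H.Carrier) →
             (∀ i → h i H.≤ k i) → ψ I h A.⊢[ I ] ψ I k
    ψφ : ∀ (I : Set ℓ) (a : I → A.Carrier) →
         (ψ I (φ I a) A.⊢[ I ] a) × (a A.⊢[ I ] ψ I (φ I a))
    φψ : ∀ (I : Set ℓ) (h : I → H.Carrier) → ∀ i → φ I (ψ I h) i H.≈ h i
    natural : ∀ (I J : Set ℓ) (f : I → J) (a : J → A.Carrier) →
              ∀ i → φ I (λ x → a (f x)) i H.≈ φ J a (f i)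

IsoToForcingTripos : ∀ {ℓ} → ImplicativeAlgebra ℓ → Set (lsuc ℓ)
IsoToForcingTripos {ℓ} 𝒜 =
  Σ (CompleteHeytingAlgebra ℓ) λ H → TriposIso 𝒜 H

module Submission where

-- The key observation is that S is a principal filter ↑s exactly when
-- entailment in the induced tripos is "pointwise": a family a entails b
-- over I as soon as every a i → b i lies in S (the single realizer s then
-- works uniformly).
--  * (2 ⇒ 1): for principal S the order a ≤ b :⇔ (a → b) ∈ S makes 𝒜 a
--    complete Heyting algebra H, and since entailment is pointwise the
--    identity maps give a natural isomorphism P ≅ H^(-).
--  * (1 ⇒ 2): any isomorphism with a forcing tripos forces entailment to be
--    pointwise (entailment in H^I is pointwise and φ is natural).  Applied to
--    the family 𝐊 ⊢ b indexed by all b ∈ S, this yields one t ∈ S with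
--    t ≼ 𝐊 → b for all b ∈ S, so t𝐊 generates S.
--  * (2 ⇒ 3) is immediate.  (3 ⇒ 2): with ⋔ ∈ S a finite generating set
--    has a meet in S; a fixed-point combinator built from ⋔ gives e ∈ S
--    below this meet, 𝐊, 𝐒 and with e ≼ ee, which makes ↑e a separator
--    containing the generators, hence S = ↑e.

open import Defs
open import Level using (Level; Lift; lift)
open import Data.Product using (_×_; Σ; _,_; proj₁; proj₂)
open import Function.Bundles using (_⇔_; mk⇔)
open import Data.Nat using (zero; suc)
open import Data.Fin using (Fin; zero; suc)
open import Data.Bool using (true; false)
open import Data.Unit using (⊤; tt)

module Combinators {ℓ : Level} (𝒜 : ImplicativeStructure ℓ) where
  open ImplicativeStructure 𝒜

  app-elim : ∀ {t a c} → t ≼ a ⇒ c → app t a ≼ c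
  app-elim {t} {a} {c} p = ⋀-lb {Σ Carrier (λ c → t ≼ (a ⇒ c))} proj₁ (c , p)

  app-intro : ∀ {t a} → t ≼ a ⇒ app t a
  app-intro {t} {a} =
    ≼-trans (⋀-glb {Σ Carrier (λ c → t ≼ (a ⇒ c))} (λ x → a ⇒ proj₁ x) t proj₂)
            (proj₂ (⇒-⋀ a proj₁))

  ⇒-intro : ∀ {t a c} → app t a ≼ c → t ≼ a ⇒ c
  ⇒-intro p = ≼-trans app-intro (⇒-mono ≼-refl p)

  ⇒-β : ∀ {a b} → app (a ⇒ b) a ≼ b
  ⇒-β = app-elim ≼-refl

  app-monoˡ : ∀ {t t′ a} → t ≼ t′ → app t a ≼ app t′ a
  app-monoˡ p = app-elim (≼-trans p app-intro)

  app-monoʳ : ∀ {t a a′} → a′ ≼ a → app t a′ ≼ app t a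
  app-monoʳ q = app-elim (≼-trans app-intro (⇒-mono q ≼-refl))

  app-mono : ∀ {t t′ a a′} → t ≼ t′ → a ≼ a′ → app t a ≼ app t′ a′
  app-mono p q = ≼-trans (app-monoˡ p) (app-monoʳ q)

  abs-β : ∀ f a → app (abs f) a ≼ f a
  abs-β f a = app-elim (⋀-lb (λ x → x ⇒ f x) a)

  𝐈 : Carrier
  𝐈 = abs (λ x → x)

  𝐈-β : ∀ {a} → app 𝐈 a ≼ a
  𝐈-β {a} = abs-β (λ x → x) a

  𝐈-refl : ∀ a → 𝐈 ≼ a ⇒ a
  𝐈-refl a = ⋀-lb (λ x → x ⇒ x) a

  𝐊-β₁ : ∀ {a} → app 𝐊 a ≼ abs (λ _ → a)
  𝐊-β₁ {a} = abs-β (λ x → abs (λ _ → x)) a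

  𝐊-β : ∀ {a b} → app (app 𝐊 a) b ≼ a
  𝐊-β {a} {b} = ≼-trans (app-monoˡ 𝐊-β₁) (abs-β (λ _ → a) b)

  𝐊-const : ∀ {a} → app 𝐊 a ≼ 𝐊 ⇒ a
  𝐊-const {a} = ≼-trans 𝐊-β₁ (⋀-lb (λ _ → _ ⇒ a) 𝐊)

  𝐊𝐈-β : ∀ {a b} → app (app 𝐊𝐈 a) b ≼ b
  𝐊𝐈-β {a} {b} =
    ≼-trans (app-monoˡ (abs-β (λ x → abs (λ y → y)) a)) (abs-β (λ y → y) b)

  𝐒-β : ∀ {a b c} → app (app (app 𝐒 a) b) c ≼ app (app a c) (app b c)
  𝐒-β {a} {b} {c} =
    ≼-trans (app-monoˡ (app-monoˡ
              (abs-β (λ x → abs (λ y → abs (λ z → app (app x z) (app y z)))) a)))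
    (≼-trans (app-monoˡ (abs-β (λ y → abs (λ z → app (app a z) (app y z))) b))
             (abs-β (λ z → app (app a z) (app b z)) c))

  ∧-lbˡ : ∀ {a b} → a ∧ b ≼ a
  ∧-lbˡ = ⋀-lb _ (lift true)

  ∧-lbʳ : ∀ {a b} → a ∧ b ≼ b
  ∧-lbʳ = ⋀-lb _ (lift false)

  ∧-glb : ∀ {a b c} → c ≼ a → c ≼ b → c ≼ a ∧ b
  ∧-glb {c = c} p q = ⋀-glb _ c (λ { (lift true) → p ; (lift false) → q })

  ⇒-∧ : ∀ {a b c} → (c ⇒ a) ∧ (c ⇒ b) ≼ c ⇒ (a ∧ b)
  ⇒-∧ {c = c} =
    ≼-trans (⋀-glb _ _ (λ { (lift true) → ∧-lbˡ ; (lift false) → ∧-lbʳ }))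
            (proj₂ (⇒-⋀ c _))

  ⋔-β : ∀ {a b} → app (app ⋔ a) b ≼ a ∧ b
  ⋔-β = ∧-glb (≼-trans (app-monoˡ (app-monoˡ ∧-lbˡ)) 𝐊-β)
              (≼-trans (app-monoˡ (app-monoˡ ∧-lbʳ)) 𝐊𝐈-β)

  𝐁 : Carrier → Carrier → Carrier
  𝐁 g f = app (app 𝐒 (app 𝐊 g)) f

  𝐁-β : ∀ {g f a} → app (𝐁 g f) a ≼ app g (app f a)
  𝐁-β = ≼-trans 𝐒-β (app-monoˡ 𝐊-β)

  𝐁-typing : ∀ {f g a b c} → f ≼ a ⇒ b → g ≼ b ⇒ c → 𝐁 g f ≼ a ⇒ c
  𝐁-typing p q = ⇒-intro (≼-trans 𝐁-β (≼-trans (app-monoʳ (app-elim p)) (app-elim q)))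

  -- An element below 𝐊 and 𝐒 that realises its own self-application
  -- generates a separator: ↑e is closed under modus ponens since
  -- e ≼ ee ≼ (a → b)a ≼ b whenever e ≼ a → b and e ≼ a.
  upset-separator : ∀ {e} → e ≼ 𝐊 → e ≼ 𝐒 → e ≼ app e e → IsSeparator (e ≼_)
  upset-separator e≼𝐊 e≼𝐒 e≼ee = record
    { upward = ≼-trans
    ; has-𝐊  = e≼𝐊
    ; has-𝐒  = e≼𝐒
    ; mp     = λ p q → ≼-trans e≼ee (≼-trans (app-mono p q) ⇒-β)
    }

module Separator {ℓ : Level} (𝒜 : ImplicativeStructure ℓ)
                 {S : ImplicativeStructure.Carrier 𝒜 → Set ℓ}
                 (sep : ImplicativeStructure.IsSeparator 𝒜 S) where
  open ImplicativeStructure 𝒜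
  open IsSeparator sep
  open Combinators 𝒜

  app-closed : ∀ {a b} → S a → S b → S (app a b)
  app-closed sa sb = mp (upward sa app-intro) sb

  𝐈∈S : S 𝐈
  𝐈∈S = upward (app-closed (app-closed has-𝐒 has-𝐊) has-𝐊)
               (⋀-glb _ _ (λ _ → ⇒-intro (≼-trans 𝐒-β 𝐊-β)))

  𝐊𝐈∈S : S 𝐊𝐈
  𝐊𝐈∈S = upward (app-closed has-𝐊 𝐈∈S) 𝐊-β₁

  𝐁-closed : ∀ {g f} → S g → S f → S (𝐁 g f)
  𝐁-closed sg sf = app-closed (app-closed has-𝐒 (app-closed has-𝐊 sg)) sf

  ≼⇒S : ∀ {a b} → a ≼ b → S (a ⇒ b)
  ≼⇒S p = upward 𝐈∈S (≼-trans (𝐈-refl _) (⇒-mono ≼-refl p))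

  ⇒-trans : ∀ {a b c} → S (a ⇒ b) → S (b ⇒ c) → S (a ⇒ c)
  ⇒-trans p q = upward (𝐁-closed q p) (𝐁-typing ≼-refl ≼-refl)

  -- Uncurrying is always realised:  λx. f (π₁x) (π₂x)  with  f ∈ S.
  uncurry : ∀ {a b c} → S (a ⇒ b ⇒ c) → S (a ∧ b ⇒ c)
  uncurry p =
    upward (app-closed (app-closed has-𝐒 p) 𝐈∈S)
      (⇒-intro (≼-trans 𝐒-β
        (≼-trans (app-mono (app-monoʳ ∧-lbˡ) (≼-trans 𝐈-β ∧-lbʳ))
                 (≼-trans (app-monoˡ ⇒-β) ⇒-β))))

  -- Currying needs ⋔ to pair its two arguments:  λxy. f (⋔xy).
  curry : S ⋔ → ∀ {a b c} → S (a ∧ b ⇒ c) → S (a ⇒ b ⇒ c)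
  curry s⋔ p =
    upward (𝐁-closed (app-closed has-𝐒 (app-closed has-𝐊 p)) s⋔)
      (⇒-intro (⇒-intro
        (≼-trans (app-monoˡ 𝐁-β)
          (≼-trans 𝐒-β (≼-trans (app-mono 𝐊-β ⋔-β) ⇒-β)))))

  ∧-closed : S ⋔ → ∀ {a b} → S a → S b → S (a ∧ b)
  ∧-closed s⋔ sa sb = upward (app-closed (app-closed s⋔ sa) sb) ⋔-β

  finite-lower-bound : S ⋔ → ∀ n (X : Fin n → Carrier) → (∀ i → S (X i)) →
                       Σ Carrier λ m → S m × (∀ i → m ≼ X i)
  finite-lower-bound s⋔ zero    X X∈S = 𝐊 , has-𝐊 , λ ()
  finite-lower-bound s⋔ (suc n) X X∈S
    with finite-lower-bound s⋔ n (λ i → X (suc i)) (λ i → X∈S (suc i))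
  ... | m , m∈S , m≼ =
    X zero ∧ m , ∧-closed s⋔ (X∈S zero) m∈S ,
    λ { zero → ∧-lbˡ ; (suc i) → ≼-trans ∧-lbʳ (m≼ i) }

  -- A fixed point of  x ↦ c ∧ xx :  with  D = λx. ⋔ c (xx(xx))  the
  -- element e = DD satisfies e ≼ c ∧ ee.  It is built from 𝐒, 𝐊, ⋔ and c,
  -- so it lies in S whenever c does.
  self-applicative-below : S ⋔ → ∀ {c} → S c →
                           Σ Carrier λ e → S e × e ≼ c × e ≼ app e e
  self-applicative-below s⋔ {c} c∈S = app D D , app-closed D∈S D∈S ,
                                      ≼-trans D-β ∧-lbˡ , ≼-trans D-β ∧-lbʳ
    where
      M : Carrier
      M = app (app 𝐒 𝐈) 𝐈
      M-β : ∀ {x} → app M x ≼ app x x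
      M-β = ≼-trans 𝐒-β (app-mono 𝐈-β 𝐈-β)
      W : Carrier
      W = app (app 𝐒 M) M
      W-β : ∀ {x} → app W x ≼ app (app x x) (app x x)
      W-β = ≼-trans 𝐒-β (app-mono M-β M-β)
      D : Carrier
      D = 𝐁 (app ⋔ c) W
      D-β : ∀ {x} → app D x ≼ c ∧ app (app x x) (app x x)
      D-β = ≼-trans 𝐁-β (≼-trans ⋔-β (∧-glb ∧-lbˡ (≼-trans ∧-lbʳ W-β)))
      M∈S : S M
      M∈S = app-closed (app-closed has-𝐒 𝐈∈S) 𝐈∈S
      D∈S : S D
      D∈S = 𝐁-closed (app-closed s⋔ c∈S) (app-closed (app-closed has-𝐒 M∈S) M∈S)

module Entailment {ℓ : Level} (𝒜 : ImplicativeAlgebra ℓ) where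
  open ImplicativeAlgebra 𝒜
  open IsSeparator isSeparator
  open Combinators structure
  open Separator structure isSeparator

  ⊢-refl : ∀ {I : Set ℓ} (a : I → Carrier) → a ⊢[ I ] a
  ⊢-refl a = 𝐈 , 𝐈∈S , λ i → 𝐈-refl (a i)

  ⊢-trans : ∀ {I : Set ℓ} {a b c : I → Carrier} →
            a ⊢[ I ] b → b ⊢[ I ] c → a ⊢[ I ] c
  ⊢-trans (t , t∈S , t≼) (u , u∈S , u≼) =
    𝐁 u t , 𝐁-closed u∈S t∈S , λ i → 𝐁-typing (t≼ i) (u≼ i)

  ⊢⇒pointwise : ∀ {I : Set ℓ} {a b : I → Carrier} →
                a ⊢[ I ] b → ∀ i → S (a i ⇒ b i)
  ⊢⇒pointwise (t , t∈S , t≼) i = upward t∈S (t≼ i)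

  -- If the tripos is isomorphic to a forcing tripos, the converse holds:
  -- test the pointwise entailment on the one-point set, move it to the
  -- index i by naturality of φ, and transport back along ψ.
  iso⇒pointwise⇒⊢ : ∀ {H} → TriposIso 𝒜 H → ∀ {I : Set ℓ} {a b : I → Carrier} →
                     (∀ i → S (a i ⇒ b i)) → a ⊢[ I ] b
  iso⇒pointwise⇒⊢ {H} iso {I} {a} {b} pointwise =
    ⊢-trans (proj₂ (ψφ I a)) (⊢-trans (ψ-mono I _ _ φa≤φb) (proj₁ (ψφ I b)))
    where
      open TriposIso iso
      module H = CompleteHeytingAlgebra H
      𝟙 : Set ℓ
      𝟙 = Lift ℓ ⊤
      φa≤φb : ∀ i → φ I a i H.≤ φ I b i
      φa≤φb i =
        H.≤-trans (proj₂ (natural 𝟙 I (λ _ → i) a (lift tt)))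
          (H.≤-trans (φ-mono 𝟙 _ _ (_ , pointwise i , λ _ → ≼-refl) (lift tt))
                     (proj₁ (natural 𝟙 I (λ _ → i) b (lift tt))))

module Principal {ℓ : Level} (𝒜 : ImplicativeAlgebra ℓ)
                 (principal : ImplicativeAlgebra.IsPrincipalFilter 𝒜) where
  open ImplicativeAlgebra 𝒜
  open IsSeparator isSeparator
  open Combinators structure
  open Separator structure isSeparator
  open Entailment 𝒜

  s : Carrier
  s = proj₁ principal

  s∈S : S s
  s∈S = proj₂ (proj₂ principal s) ≼-refl

  s≼ : ∀ {a} → S a → s ≼ a
  s≼ = proj₁ (proj₂ principal _)

  ⋀-closed : ∀ {I : Set ℓ} (f : I → Carrier) → (∀ i → S (f i)) → S (⋀ f)
  ⋀-closed f f∈S = upward s∈S (⋀-glb f s (λ i → s≼ (f∈S i)))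

  ⇒⋀-closed : ∀ {I : Set ℓ} c (f : I → Carrier) →
              (∀ i → S (c ⇒ f i)) → S (c ⇒ ⋀ f)
  ⇒⋀-closed c f h = upward (⋀-closed _ h) (proj₂ (⇒-⋀ c f))

  ⋔∈S : S ⋔
  ⋔∈S = upward s∈S (∧-glb (s≼ has-𝐊) (s≼ 𝐊𝐈∈S))

  pointwise⇒⊢ : ∀ {I : Set ℓ} {a b : I → Carrier} →
                (∀ i → S (a i ⇒ b i)) → a ⊢[ I ] b
  pointwise⇒⊢ h = s , s∈S , λ i → s≼ (h i)

  UpperBound : ∀ {I : Set ℓ} → (I → Carrier) → Set ℓ
  UpperBound {I} f = Σ Carrier λ c → ∀ i → S (f i ⇒ c)

  ⋁ : ∀ {I : Set ℓ} → (I → Carrier) → Carrier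
  ⋁ f = ⋀ {UpperBound f} proj₁

  forcing-algebra : CompleteHeytingAlgebra ℓ
  forcing-algebra = record
    { Carrier = Carrier
    ; _≤_     = λ a b → S (a ⇒ b)
    ; ≤-refl  = ≼⇒S ≼-refl
    ; ≤-trans = ⇒-trans
    ; ⋀       = ⋀
    ; ⋀-lb    = λ f i → ≼⇒S (⋀-lb f i)
    ; ⋀-glb   = λ f c → ⇒⋀-closed c f
    ; ⋁       = ⋁
    ; ⋁-ub    = λ f i → ⇒⋀-closed (f i) proj₁ (λ u → proj₂ u i)
    ; ⋁-lub   = λ f c h → ≼⇒S (⋀-lb proj₁ (c , h))
    ; _∧_     = _∧_
    ; ∧-lbˡ   = λ _ _ → ≼⇒S ∧-lbˡ
    ; ∧-lbʳ   = λ _ _ → ≼⇒S ∧-lbʳ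
    ; ∧-glb   = λ p q → upward s∈S (≼-trans (∧-glb (s≼ p) (s≼ q)) ⇒-∧)
    ; _⇨_     = _⇒_
    ; ⇨-adjˡ  = curry ⋔∈S
    ; ⇨-adjʳ  = uncurry
    }

  -- Since entailment is pointwise, the identity is a natural isomorphism
  -- between the induced tripos and the forcing tripos of forcing-algebra.
  forcing-iso : TriposIso 𝒜 forcing-algebra
  forcing-iso = record
    { φ       = λ _ a → a
    ; ψ       = λ _ h → h
    ; φ-mono  = λ _ _ _ → ⊢⇒pointwise
    ; ψ-mono  = λ _ _ _ → pointwise⇒⊢
    ; ψφ      = λ _ a → ⊢-refl a , ⊢-refl a
    ; φψ      = λ _ _ _ → ≼⇒S ≼-refl , ≼⇒S ≼-refl
    ; natural = λ _ _ _ _ _ → ≼⇒S ≼-refl , ≼⇒S ≼-refl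
    }

module _ {ℓ : Level} (𝒜 : ImplicativeAlgebra ℓ) where
  open ImplicativeAlgebra 𝒜
  open IsSeparator isSeparator
  open Combinators structure
  open Separator structure isSeparator
  open Entailment 𝒜

  principal⇒forcing : IsPrincipalFilter → IsoToForcingTripos 𝒜
  principal⇒forcing principal = forcing-algebra , forcing-iso
    where open Principal 𝒜 principal

  -- (1 ⇒ 2): every b ∈ S satisfies (𝐊 → b) ∈ S; if this family of entailments is
  -- uniform, realised by t ∈ S, then t𝐊 ∈ S lies below every b ∈ S.
  forcing⇒principal : IsoToForcingTripos 𝒜 → IsPrincipalFilter
  forcing⇒principal (H , iso) =
    app t 𝐊 , λ b → (λ b∈S → app-elim (t≼ (b , b∈S))) ,
                    (λ t𝐊≼b → upward (app-closed t∈S has-𝐊) t𝐊≼b)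
    where
      𝐊⊢members : (λ (_ : Σ Carrier S) → 𝐊) ⊢[ Σ Carrier S ] proj₁
      𝐊⊢members =
        iso⇒pointwise⇒⊢ iso (λ (b , b∈S) → upward (app-closed has-𝐊 b∈S) 𝐊-const)
      t : Carrier
      t = proj₁ 𝐊⊢members
      t∈S : S t
      t∈S = proj₁ (proj₂ 𝐊⊢members)
      t≼ : ∀ (b : Σ Carrier S) → t ≼ 𝐊 ⇒ proj₁ b
      t≼ = proj₂ (proj₂ 𝐊⊢members)

  principal⇒finitely-generated : IsPrincipalFilter → FinitelyGenerated × S ⋔
  principal⇒finitely-generated principal =
    (1 , (λ _ → s) , (λ _ → s∈S) ,
      λ S′ sep′ s∈S′ a a∈S → IsSeparator.upward sep′ (s∈S′ zero) (s≼ a∈S)) ,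
    ⋔∈S
    where open Principal 𝒜 principal

  -- (3 ⇒ 2): the fixed point e below the generators, 𝐊 and 𝐒 generates a separator
  -- ↑e containing the generators; minimality of S gives S ⊆ ↑e, and
  -- e ∈ S gives ↑e ⊆ S.
  finitely-generated⇒principal : FinitelyGenerated × S ⋔ → IsPrincipalFilter
  finitely-generated⇒principal ((n , X , X∈S , minimal) , s⋔) =
    e , λ a → minimal (e ≼_) ↑e-separator e≼X a , upward e∈S
    where
      bound : Σ Carrier λ m → S m × (∀ i → m ≼ X i)
      bound = finite-lower-bound s⋔ n X X∈S
      m : Carrier
      m = proj₁ bound
      fixed : Σ Carrier λ e → S e × e ≼ m ∧ (𝐊 ∧ 𝐒) × e ≼ app e e
      fixed = self-applicative-below s⋔
                (∧-closed s⋔ (proj₁ (proj₂ bound)) (∧-closed s⋔ has-𝐊 has-𝐒))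
      e : Carrier
      e = proj₁ fixed
      e∈S : S e
      e∈S = proj₁ (proj₂ fixed)
      e≼m∧𝐊∧𝐒 : e ≼ m ∧ (𝐊 ∧ 𝐒)
      e≼m∧𝐊∧𝐒 = proj₁ (proj₂ (proj₂ fixed))
      e≼X : ∀ i → e ≼ X i
      e≼X i = ≼-trans e≼m∧𝐊∧𝐒 (≼-trans ∧-lbˡ (proj₂ (proj₂ bound) i))
      ↑e-separator : IsSeparator (e ≼_)
      ↑e-separator = upset-separator (≼-trans e≼m∧𝐊∧𝐒 (≼-trans ∧-lbʳ ∧-lbˡ))
                                     (≼-trans e≼m∧𝐊∧𝐒 (≼-trans ∧-lbʳ ∧-lbʳ))
                                     (proj₂ (proj₂ (proj₂ fixed)))

theorem4p13 : ∀ {ℓ : Level} (𝒜 : ImplicativeAlgebra ℓ) →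
    (IsoToForcingTripos 𝒜 ⇔ ImplicativeAlgebra.IsPrincipalFilter 𝒜) ×
    (ImplicativeAlgebra.IsPrincipalFilter 𝒜 ⇔
      (ImplicativeAlgebra.FinitelyGenerated 𝒜 × ImplicativeAlgebra.S 𝒜 (ImplicativeAlgebra.⋔ 𝒜)))
theorem4p13 𝒜 =
  mk⇔ (forcing⇒principal 𝒜) (principal⇒forcing 𝒜) ,
  mk⇔ (principal⇒finitely-generated 𝒜) (finitely-generated⇒principal 𝒜)
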